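{- For every integer $n\geq 2$, every $n$-vertex (simple) graph with no dominating $K_4$-model has at most $2n-3$ edges.
   Context: A dominating $K_t$-model in a graph $G$ is a sequence $(T_1,\dots,T_t)$ of pairwise disjoint non-empty connected subgraphs of $G$ such that for all $1\le i<j\le t$, every vertex of $T_j$ has a neighbour in $T_i$. -}

module Defs where

open import Data.Nat using (ℕ; zero; suc; _+_; _<ᵇ_)
open import Data.Bool using (Bool; true; false; _∧_; if_then_else_)
open import Data.Fin using (Fin; toℕ; _<_)
open import Data.Fin.Subset using (Subset; _∈_; Nonempty)
open import Data.List using (List; allFin; map)
open import Data.Nat.ListAction using (sum)
open import Data.Product using (Σ; ∃; _×_; _,_)
open import Relation.Binary.PropositionalEquality using (_≡_; _≢_)
open import Relation.Nullary using (¬_)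

record Graph (n : ℕ) : Set where
  field
    adj   : Fin n → Fin n → Bool
    sym   : ∀ u v → adj u v ≡ adj v u
    irrfl : ∀ v → adj v v ≡ false
open Graph public

Adj : ∀ {n} → Graph n → Fin n → Fin n → Set
Adj G u v = adj G u v ≡ true

edgeCount : ∀ {n} → Graph n → ℕ
edgeCount {n} G =
  sum (map (λ u → sum (map (λ v → if (toℕ u <ᵇ toℕ v) ∧ adj G u v then 1 else 0)
                           (allFin n)))
           (allFin n))

data WalkIn {n} (G : Graph n) (S : Subset n) : Fin n → Fin n → Set where
  here : ∀ {u} → u ∈ S → WalkIn G S u u
  step : ∀ {u w v} → u ∈ S → Adj G u w → WalkIn G S w v → WalkIn G S u v

Connected : ∀ {n} → Graph n → Subset n → Set
Connected G S = ∀ u v → u ∈ S → v ∈ S → WalkIn G S u v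

Disjoint : ∀ {n} → Subset n → Subset n → Set
Disjoint S T = ∀ v → v ∈ S → ¬ (v ∈ T)

-- A dominating K_t-model (T_1,...,T_t), indexed by Fin t; each T_i is given
-- by its vertex set, the subgraph being the (connected) induced subgraph.
record DominatingModel {n} (G : Graph n) (t : ℕ) : Set where
  field
    T         : Fin t → Subset n
    nonempty  : ∀ i → Nonempty (T i)
    connected : ∀ i → Connected G (T i)
    disjoint  : ∀ i j → i ≢ j → Disjoint (T i) (T j)
    dominates : ∀ i j → i < j → ∀ v → v ∈ T j →
                ∃ λ u → u ∈ T i × Adj G v u

-- Write e(S) for the number of edges inside a vertex set S. By induction on |H|,
-- every H either satisfies e(H) ≤ 2|H| − 3 or contains a dominating K₄-model.
-- If e(H) is larger, pick w ∈ H and grow a connected root X = {w} outside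
-- P = H − w, keeping track of the set Q ⊆ P of vertices adjacent to X. While some
-- y ∈ Q has at most one neighbour in Q, contract y into X (so that Q becomes the
-- vertices of P − y adjacent to X ∪ {y}); the surplus e(P) + |Q| − 2|P| never
-- decreases. When this stops, the bound on e(P) from the induction hypothesis
-- forces Q ≠ ∅, and Q has minimum degree 2, so e(Q) ≥ |Q|. The same argument one
-- level down (e(Q) ≤ |Q| − 1 unless Q contains a dominating K₃-model, the last
-- step now producing an edge) gives a dominating K₃-model in Q, and X dominates
-- Q, so prefixing X yields a dominating K₄-model.
module Submission where

open import Data.Bool using (Bool; true; false; _∧_; _∨_; not; if_then_else_)
open import Data.Bool.Properties using (∧-conicalˡ; ∧-conicalʳ; ∧-zeroʳ) renaming (_≟_ to _≟ᵇ_)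
open import Data.Empty using (⊥-elim)
open import Data.Fin using (Fin; zero; suc; toℕ)
open import Data.Fin.Properties using (_≟_; any?; toℕ-injective)
open import Data.Fin.Subset as Subset using (Subset; _∈_; _⊆_; Nonempty; ⁅_⁆)
open import Data.Fin.Subset.Properties using (x∈⁅x⁆; x∈⁅y⁆⇒x≡y; x∈p∪q⁻; p⊆p∪q; q⊆p∪q)
open import Data.List using (map; tabulate)
open import Data.Nat using (ℕ; zero; suc; _+_; _*_; _∸_; _≤_; _<_; _≤?_; _<?_; _<ᵇ_; z≤n; s≤s; z<s)
open import Data.Nat.Induction using (<-wellFounded)
open import Data.Nat.ListAction as List using ()
open import Data.Nat.Properties hiding (_≟_)
open import Data.Nat.Tactic.RingSolver using (solve-∀)
open import Data.Product using (Σ; ∃; _×_; _,_)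
open import Data.Sum using (_⊎_; inj₁; inj₂)
open import Function using (_∘_; id)
open import Induction.WellFounded using (Acc; acc)
open import Relation.Binary.PropositionalEquality
open import Relation.Nullary using (¬_; yes; no; _×-dec_)
open import Relation.Nullary.Decidable using (does; dec-true)
open import Relation.Nullary.Reflects using (ofʸ; ofⁿ)

open import Algebra.Properties.Semiring.Sum +-*-semiring
  using (sum; sum-syntax; ∑-distrib-+; ∑-comm; sum-cong-≗; sum-replicate-zero; *-distribʳ-sum)

open import Defs renaming (sym to adj-sym)

private variable
  n t : ℕ

∑-mono-≤ : ∀ {m} {f g : Fin m → ℕ} → (∀ i → f i ≤ g i) → sum f ≤ sum g
∑-mono-≤ {zero}  _   = z≤n
∑-mono-≤ {suc m} f≤g = +-mono-≤ (f≤g zero) (∑-mono-≤ (f≤g ∘ suc))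

∑-point : ∀ {m} (y : Fin m) c → (∑[ u < m ] (if does (u ≟ y) then c else 0)) ≡ c
∑-point {suc m} zero    c = trans (cong (c +_) (sum-replicate-zero m)) (+-identityʳ c)
∑-point {suc m} (suc y) c = ∑-point y c

∑-point-split : ∀ {m} (y : Fin m) {f g : Fin m → ℕ} c →
                (∀ u → f u ≡ g u + (if does (u ≟ y) then c else 0)) → sum f ≡ sum g + c
∑-point-split y {f} {g} c f≡g+δ = begin
  sum f                                                   ≡⟨ sum-cong-≗ f≡g+δ ⟩
  sum (λ u → g u + (if does (u ≟ y) then c else 0))      ≡⟨ ∑-distrib-+ g _ ⟩
  sum g + (∑[ u < _ ] (if does (u ≟ y) then c else 0))   ≡⟨ cong (sum g +_) (∑-point y c) ⟩
  sum g + c                                               ∎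
  where open ≡-Reasoning

sum-map-tabulate : ∀ {A : Set} {m} (f : A → ℕ) (g : Fin m → A) →
                   List.sum (map f (tabulate g)) ≡ sum (f ∘ g)
sum-map-tabulate {m = zero}  f g = refl
sum-map-tabulate {m = suc m} f g = cong (f (g zero) +_) (sum-map-tabulate f (g ∘ suc))

m*2≡m+m : ∀ m → m * 2 ≡ m + m
m*2≡m+m = solve-∀

[n∸1]*2<n*2 : ∀ {n} → 0 < n → (n ∸ 1) * 2 < n * 2
[n∸1]*2<n*2 {suc n} _ = s≤s (n≤1+n (n * 2))

[n∸1]*4≤2+[n*2∸3]*2 : ∀ n → (n ∸ 1) * 4 ≤ 2 + (n * 2 ∸ 3) * 2
[n∸1]*4≤2+[n*2∸3]*2 zero          = z≤n
[n∸1]*4≤2+[n*2∸3]*2 (suc zero)    = z≤n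
[n∸1]*4≤2+[n*2∸3]*2 (suc (suc n)) = ≤-reflexive (cong (4 +_) (sym (*-assoc n 2 2)))

2+[n*2∸3]*2≤n*4 : ∀ {n} → 0 < n → 2 + (n * 2 ∸ 3) * 2 ≤ n * 4
2+[n*2∸3]*2≤n*4 {suc zero}    _ = s≤s (s≤s z≤n)
2+[n*2∸3]*2≤n*4 {suc (suc n)} _ =
  ≤-trans (≤-reflexive (cong (4 +_) (*-assoc n 2 2))) (+-monoʳ-≤ 4 (m≤n+m (n * 4) 4))

dense-step : ∀ {j d} p w → d ≤ j →
             suc p * (suc j * 2) < j * 2 + (w + suc d * 2) → p * (suc j * 2) < j * 2 + w
dense-step {j} {d} p w d≤j before = +-cancelˡ-< (suc j * 2) _ _ (<-≤-trans before (begin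
  j * 2 + (w + suc d * 2)      ≤⟨ +-monoʳ-≤ (j * 2) (+-monoʳ-≤ w (*-monoˡ-≤ 2 (s≤s d≤j))) ⟩
  j * 2 + (w + suc j * 2)      ≡⟨ rearrange j w ⟩
  suc j * 2 + (j * 2 + w)      ∎))
  where
  open ≤-Reasoning
  rearrange : ∀ j w → j * 2 + (w + suc j * 2) ≡ suc j * 2 + (j * 2 + w)
  rearrange = solve-∀

-- Vertex sets that get counted are Boolean predicates, so that sizes and degrees
-- are sums of indicators computed by case analysis; the branch sets of models
-- remain library Subsets.
VertexSet : ℕ → Set
VertexSet n = Fin n → Bool

infix  4 _∈ᵛ_ _⊆ᵛ_
infixl 8 _∖_
infixl 7 _∩_ _∪_

_∈ᵛ_ : Fin n → VertexSet n → Set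
v ∈ᵛ S = S v ≡ true

_⊆ᵛ_ : VertexSet n → VertexSet n → Set
S ⊆ᵛ T = ∀ {v} → v ∈ᵛ S → v ∈ᵛ T

_∩_ _∪_ : VertexSet n → VertexSet n → VertexSet n
(S ∩ T) v = S v ∧ T v
(S ∪ T) v = S v ∨ T v

_∖_ : VertexSet n → Fin n → VertexSet n
(S ∖ y) v = S v ∧ not (does (v ≟ y))

∩⊆ˡ : ∀ (S T : VertexSet n) → S ∩ T ⊆ᵛ S
∩⊆ˡ S T {v} = ∧-conicalˡ (S v) (T v)

∩⊆ʳ : ∀ (S T : VertexSet n) → S ∩ T ⊆ᵛ T
∩⊆ʳ S T {v} = ∧-conicalʳ (S v) (T v)

∪⁻ : ∀ (S T : VertexSet n) {v} → v ∈ᵛ S ∪ T → v ∈ᵛ S ⊎ v ∈ᵛ T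
∪⁻ S T {v} v∈S∪T with S v
... | true  = inj₁ refl
... | false = inj₂ v∈S∪T

∖⊆ : ∀ (S : VertexSet n) y → S ∖ y ⊆ᵛ S
∖⊆ S y {v} = ∧-conicalˡ (S v) _

y∉S∖y : ∀ (S : VertexSet n) y → (S ∖ y) y ≡ false
y∉S∖y S y rewrite dec-true (y ≟ y) refl = ∧-zeroʳ (S y)

𝟙 : Bool → ℕ
𝟙 b = if b then 1 else 0

card : VertexSet n → ℕ
card {n} S = ∑[ v < n ] 𝟙 (S v)

card-all : ∀ n → card {n} (λ _ → true) ≡ n
card-all zero    = refl
card-all (suc n) = cong suc (card-all n)

card-mono : ∀ {S T : VertexSet n} → S ⊆ᵛ T → card S ≤ card T
card-mono {S = S} {T} S⊆T = ∑-mono-≤ pointwise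
  where
  pointwise : ∀ v → 𝟙 (S v) ≤ 𝟙 (T v)
  pointwise v with S v in v∈S
  ... | true  rewrite S⊆T v∈S = ≤-refl
  ... | false = z≤n

0<card⇒member : ∀ {S : VertexSet n} → 0 < card S → ∃ λ v → v ∈ᵛ S
0<card⇒member {suc n} {S} 0<card with S zero in 0∈S
... | true  = zero , 0∈S
... | false = let v , v∈S = 0<card⇒member {S = S ∘ suc} 0<card in suc v , v∈S

card-∖ : ∀ (S : VertexSet n) {y} → y ∈ᵛ S → card S ≡ suc (card (S ∖ y))
card-∖ S {y} y∈S = trans (∑-point-split y 1 pointwise) (+-comm _ 1)
  where
  pointwise : ∀ v → 𝟙 (S v) ≡ 𝟙 ((S ∖ y) v) + (if does (v ≟ y) then 1 else 0)
  pointwise v with v ≟ y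
  ... | yes refl rewrite y∈S = refl
  ... | no _ with S v
  ...   | true  = refl
  ...   | false = refl

module _ (G : Graph n) where

  Adj-sym : ∀ {u v} → Adj G u v → Adj G v u
  Adj-sym {u} {v} uv = trans (adj-sym G v u) uv

  Adj-irrefl : ∀ {v} → ¬ Adj G v v
  Adj-irrefl {v} vv with trans (sym vv) (irrfl G v)
  ... | ()

  N : Fin n → VertexSet n
  N = adj G

  degIn : VertexSet n → Fin n → ℕ
  degIn S u = card (S ∩ N u)

  -- twice the number of edges of G[S]
  degSum : VertexSet n → ℕ
  degSum S = ∑[ u < n ] (if S u then degIn S u else 0)

  degIn-∖ : ∀ {S y} u → y ∈ᵛ S → degIn S u ≡ degIn (S ∖ y) u + 𝟙 (adj G u y)
  degIn-∖ {S} {y} u y∈S = ∑-point-split y (𝟙 (adj G u y)) pointwise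
    where
    pointwise : ∀ v → 𝟙 ((S ∩ N u) v) ≡
                      𝟙 ((S ∖ y ∩ N u) v) + (if does (v ≟ y) then 𝟙 (adj G u y) else 0)
    pointwise v with v ≟ y
    ... | yes refl rewrite y∈S = refl
    ... | no _ with S v | adj G u v
    ...   | true  | true  = refl
    ...   | true  | false = refl
    ...   | false | _     = refl

  degSum-∖ : ∀ {S y} → y ∈ᵛ S → degSum S ≡ degSum (S ∖ y) + degIn (S ∖ y) y * 2
  degSum-∖ {S} {y} y∈S = begin
    degSum S                                            ≡⟨ ∑-point-split y (degIn S′ y) pointwise ⟩
    sum (λ u → deg′ u + 𝟙 ((S′ ∩ N y) u)) + degIn S′ y  ≡⟨ cong (_+ degIn S′ y) (∑-distrib-+ deg′ _) ⟩
    degSum S′ + degIn S′ y + degIn S′ y                 ≡⟨ +-assoc (degSum S′) _ _ ⟩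
    degSum S′ + (degIn S′ y + degIn S′ y)               ≡⟨ cong (degSum S′ +_) (m*2≡m+m (degIn S′ y)) ⟨
    degSum S′ + degIn S′ y * 2                          ∎
    where
    open ≡-Reasoning
    S′ : VertexSet n
    S′ = S ∖ y
    deg′ : Fin n → ℕ
    deg′ u = if S′ u then degIn S′ u else 0
    pointwise : ∀ u → (if S u then degIn S u else 0) ≡
                      deg′ u + 𝟙 ((S′ ∩ N y) u) + (if does (u ≟ y) then degIn S′ y else 0)
    pointwise u with u ≟ y
    ... | yes refl rewrite y∈S =
      trans (degIn-∖ u y∈S) (trans (cong (λ b → degIn S′ u + 𝟙 b) (irrfl G u)) (+-identityʳ _))
    ... | no _ with S u
    ...   | false = refl
    ...   | true  =
      trans (degIn-∖ u y∈S) (trans (cong (λ b → degIn S′ u + 𝟙 b) (adj-sym G u y)) (sym (+-identityʳ _)))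

  degIn<card : ∀ {S u} → u ∈ᵛ S → degIn S u < card S
  degIn<card {S} {u} u∈S = begin-strict
    card (S ∩ N u)      ≤⟨ card-mono {S = S ∩ N u} {S ∖ u} S∩Nu⊆S∖u ⟩
    card (S ∖ u)        <⟨ n<1+n _ ⟩
    suc (card (S ∖ u))  ≡⟨ card-∖ S u∈S ⟨
    card S              ∎
    where
    open ≤-Reasoning
    S∩Nu⊆S∖u : S ∩ N u ⊆ᵛ S ∖ u
    S∩Nu⊆S∖u {v} v∈S∩Nu with v ≟ u
    ... | yes refl = ⊥-elim (Adj-irrefl (∩⊆ʳ S (N u) v∈S∩Nu))
    ... | no _ rewrite ∩⊆ˡ S (N u) v∈S∩Nu = refl

  degSum≤card*[card∸1] : ∀ S → degSum S ≤ card S * (card S ∸ 1)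
  degSum≤card*[card∸1] S = begin
    degSum S                              ≤⟨ ∑-mono-≤ pointwise ⟩
    ∑[ u < n ] (𝟙 (S u) * (card S ∸ 1))   ≡⟨ *-distribʳ-sum (card S ∸ 1) (𝟙 ∘ S) ⟨
    card S * (card S ∸ 1)                 ∎
    where
    open ≤-Reasoning
    pointwise : ∀ u → (if S u then degIn S u else 0) ≤ 𝟙 (S u) * (card S ∸ 1)
    pointwise u with S u in u∈S
    ... | true  = ≤-trans (<⇒≤pred (degIn<card u∈S)) (≤-reflexive (sym (+-identityʳ _)))
    ... | false = z≤n

  card≤1⇒degSum≡0 : ∀ S → card S ≤ 1 → degSum S ≡ 0
  card≤1⇒degSum≡0 S card≤1 = n≤0⇒n≡0 (begin
    degSum S               ≤⟨ degSum≤card*[card∸1] S ⟩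
    card S * (card S ∸ 1)  ≡⟨ cong (card S *_) (m≤n⇒m∸n≡0 card≤1) ⟩
    card S * 0             ≡⟨ *-zeroʳ (card S) ⟩
    0                      ∎)
    where open ≤-Reasoning

  0<degSum⇒1<card : ∀ S → 0 < degSum S → 1 < card S
  0<degSum⇒1<card S 0<degSum = ≰⇒> λ card≤1 → <⇒≢ 0<degSum (sym (card≤1⇒degSum≡0 S card≤1))

  MinDegree : ℕ → VertexSet n → Set
  MinDegree k S = ∀ {u} → u ∈ᵛ S → k ≤ degIn S u

  MinDegree⇒card*k≤degSum : ∀ {k} S → MinDegree k S → card S * k ≤ degSum S
  MinDegree⇒card*k≤degSum {k} S δ≥k = begin
    card S * k                ≡⟨ *-distribʳ-sum k (𝟙 ∘ S) ⟩
    ∑[ u < n ] (𝟙 (S u) * k)  ≤⟨ ∑-mono-≤ pointwise ⟩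
    degSum S                  ∎
    where
    open ≤-Reasoning
    pointwise : ∀ u → 𝟙 (S u) * k ≤ (if S u then degIn S u else 0)
    pointwise u with S u in u∈S
    ... | true  = ≤-trans (≤-reflexive (+-identityʳ k)) (δ≥k u∈S)
    ... | false = z≤n

  0<degIn⇒neighbour : ∀ {S u} → 0 < degIn S u → ∃ λ v → v ∈ᵛ S × Adj G u v
  0<degIn⇒neighbour {S} {u} 0<deg =
    let v , v∈S∩Nu = 0<card⇒member {S = S ∩ N u} 0<deg
    in  v , ∩⊆ˡ S (N u) v∈S∩Nu , ∩⊆ʳ S (N u) v∈S∩Nu

  handshake : edgeCount G * 2 ≡ degSum (λ _ → true)
  handshake = begin
    edgeCount G * 2                                    ≡⟨ cong (_* 2) edgeCount≡E ⟩
    E * 2                                              ≡⟨ m*2≡m+m E ⟩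
    E + E                                              ≡⟨ cong (E +_) (∑-comm e) ⟩
    E + ∑[ u < n ] ∑[ v < n ] e v u                    ≡⟨ ∑-distrib-+ (λ u → ∑[ v < n ] e u v) _ ⟨
    ∑[ u < n ] (∑[ v < n ] e u v + ∑[ v < n ] e v u)   ≡⟨ sum-cong-≗ (λ u → ∑-distrib-+ (e u) _) ⟨
    ∑[ u < n ] ∑[ v < n ] (e u v + e v u)              ≡⟨ sum-cong-≗ (λ u → sum-cong-≗ (pointwise u)) ⟨
    degSum (λ _ → true)                                ∎
    where
    open ≡-Reasoning
    e : Fin n → Fin n → ℕ
    e u v = 𝟙 ((toℕ u <ᵇ toℕ v) ∧ adj G u v)
    E : ℕ
    E = ∑[ u < n ] ∑[ v < n ] e u v
    edgeCount≡E : edgeCount G ≡ E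
    edgeCount≡E = trans (sum-map-tabulate (λ u → List.sum (map (e u) (tabulate id))) id)
                        (sum-cong-≗ λ u → sum-map-tabulate (e u) id)
    pointwise : ∀ u v → 𝟙 (adj G u v) ≡ e u v + e v u
    pointwise u v with toℕ u <ᵇ toℕ v | <ᵇ-reflects-< (toℕ u) (toℕ v)
                     | toℕ v <ᵇ toℕ u | <ᵇ-reflects-< (toℕ v) (toℕ u)
    ... | true  | ofʸ u<v | true  | ofʸ v<u = ⊥-elim (<-asym u<v v<u)
    ... | true  | _       | false | _       = sym (+-identityʳ _)
    ... | false | _       | true  | _       = cong 𝟙 (adj-sym G u v)
    ... | false | ofⁿ u≮v | false | ofⁿ v≮u with toℕ-injective (≤-antisym (≮⇒≥ v≮u) (≮⇒≥ u≮v))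
    ...   | refl rewrite irrfl G u = refl

  -- Dominating models

  walk-mono : ∀ {S T u v} → S ⊆ T → WalkIn G S u v → WalkIn G T u v
  walk-mono S⊆T (here u∈S)        = here (S⊆T u∈S)
  walk-mono S⊆T (step u∈S uw wv) = step (S⊆T u∈S) uw (walk-mono S⊆T wv)

  walk-++ : ∀ {S u w v} → WalkIn G S u w → WalkIn G S w v → WalkIn G S u v
  walk-++ (here _)            wv = wv
  walk-++ (step u∈S uw′ w′w) wv = step u∈S uw′ (walk-++ w′w wv)

  ⁅⁆-connected : ∀ {v} → Connected G ⁅ v ⁆
  ⁅⁆-connected {v} u w u∈ w∈ with x∈⁅y⁆⇒x≡y v u∈ | x∈⁅y⁆⇒x≡y v w∈
  ... | refl | refl = here u∈

  ∪⁅⁆-connected : ∀ {S x y} → Connected G S → x ∈ S → Adj G y x → Connected G (S Subset.∪ ⁅ y ⁆)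
  ∪⁅⁆-connected {S} {x} {y} S-connected x∈S yx u v u∈ v∈ = walk-++ (to-x u∈) (from-x v∈)
    where
    S⊆S∪y : S ⊆ S Subset.∪ ⁅ y ⁆
    S⊆S∪y = p⊆p∪q ⁅ y ⁆
    y∈S∪y : y ∈ S Subset.∪ ⁅ y ⁆
    y∈S∪y = q⊆p∪q S ⁅ y ⁆ (x∈⁅x⁆ y)
    to-x : ∀ {u} → u ∈ S Subset.∪ ⁅ y ⁆ → WalkIn G (S Subset.∪ ⁅ y ⁆) u x
    to-x {u} u∈ with x∈p∪q⁻ S ⁅ y ⁆ u∈
    ... | inj₁ u∈S = walk-mono S⊆S∪y (S-connected u x u∈S x∈S)
    ... | inj₂ u∈y with x∈⁅y⁆⇒x≡y y u∈y
    ...   | refl = step y∈S∪y yx (here (S⊆S∪y x∈S))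
    from-x : ∀ {v} → v ∈ S Subset.∪ ⁅ y ⁆ → WalkIn G (S Subset.∪ ⁅ y ⁆) x v
    from-x {v} v∈ with x∈p∪q⁻ S ⁅ y ⁆ v∈
    ... | inj₁ v∈S = walk-mono S⊆S∪y (S-connected x v x∈S v∈S)
    ... | inj₂ v∈y with x∈⁅y⁆⇒x≡y y v∈y
    ...   | refl = step (S⊆S∪y x∈S) (Adj-sym yx) (here y∈S∪y)

  ModelIn : (Fin n → Set) → ℕ → Set
  ModelIn H t = Σ (DominatingModel G t) λ M → ∀ i {v} → v ∈ DominatingModel.T M i → H v

  ModelIn-mono : ∀ {H H′ : Fin n → Set} → (∀ {v} → H v → H′ v) → ModelIn H t → ModelIn H′ t
  ModelIn-mono H⊆H′ (M , M⊆H) = M , λ i → H⊆H′ ∘ M⊆H i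

  extend : ∀ {H Q : Fin n → Set} {X : Subset n} →
           Nonempty X → Connected G X → (∀ {v} → v ∈ X → ¬ Q v) →
           (∀ {v} → Q v → ∃ λ u → u ∈ X × Adj G v u) →
           (∀ {v} → v ∈ X → H v) → (∀ {v} → Q v → H v) →
           ModelIn Q t → ModelIn H (suc t)
  extend {t = t} {H} {Q} {X} X≢∅ X-connected X∩Q≡∅ X-dominates X⊆H Q⊆H (M , M⊆Q) = model , inside
    where
    open DominatingModel M
    T′ : Fin (suc t) → Subset n
    T′ zero    = X
    T′ (suc i) = T i
    disjoint′ : ∀ i j → i ≢ j → Disjoint (T′ i) (T′ j)
    disjoint′ zero    zero    0≢0 = ⊥-elim (0≢0 refl)
    disjoint′ zero    (suc j) _   v v∈X v∈Tj = X∩Q≡∅ v∈X (M⊆Q j v∈Tj)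
    disjoint′ (suc i) zero    _   v v∈Ti v∈X = X∩Q≡∅ v∈X (M⊆Q i v∈Ti)
    disjoint′ (suc i) (suc j) i≢j = disjoint i j (i≢j ∘ cong suc)
    dominates′ : ∀ i j → i Data.Fin.< j → ∀ v → v ∈ T′ j → ∃ λ u → u ∈ T′ i × Adj G v u
    dominates′ zero    (suc j) _         v v∈Tj = X-dominates (M⊆Q j v∈Tj)
    dominates′ (suc i) (suc j) (s≤s i<j) = dominates i j i<j
    model : DominatingModel G (suc t)
    model = record
      { T         = T′
      ; nonempty  = λ { zero → X≢∅ ; (suc i) → nonempty i }
      ; connected = λ { zero → X-connected ; (suc i) → connected i }
      ; disjoint  = disjoint′
      ; dominates = dominates′
      }
    inside : ∀ i {v} → v ∈ T′ i → H v
    inside zero    = X⊆H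
    inside (suc i) = Q⊆H ∘ M⊆Q i

  point-model : ∀ v → ModelIn (_≡ v) 1
  point-model v = model , λ _ → x∈⁅y⁆⇒x≡y v
    where
    model : DominatingModel G 1
    model = record
      { T         = λ _ → ⁅ v ⁆
      ; nonempty  = λ _ → v , x∈⁅x⁆ v
      ; connected = λ _ → ⁅⁆-connected
      ; disjoint  = λ { zero zero 0≢0 → ⊥-elim (0≢0 refl) }
      ; dominates = λ { zero zero () }
      }

  edge-model : ∀ {H : Fin n → Set} {a b} → H a → H b → Adj G a b → ModelIn H 2
  edge-model {H = H} {a} {b} a∈H b∈H ab =
    extend (a , x∈⁅x⁆ a) ⁅⁆-connected a≢b b→a ⁅a⁆⊆H (λ { refl → b∈H }) (point-model b)
    where
    ⁅a⁆⊆H : ∀ {v} → v ∈ ⁅ a ⁆ → H v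
    ⁅a⁆⊆H v∈ with x∈⁅y⁆⇒x≡y a v∈
    ... | refl = a∈H
    a≢b : ∀ {v} → v ∈ ⁅ a ⁆ → ¬ v ≡ b
    a≢b v∈ refl with x∈⁅y⁆⇒x≡y a v∈
    ... | refl = Adj-irrefl ab
    b→a : ∀ {v} → v ≡ b → ∃ λ u → u ∈ ⁅ a ⁆ × Adj G v u
    b→a refl = a , x∈⁅x⁆ a , Adj-sym ab

  -- Rooted configurations

  record Rooted (H : VertexSet n) : Set where
    field
      X             : Subset n
      P Q           : VertexSet n
      X-nonempty    : Nonempty X
      X-connected   : Connected G X
      X⊆H           : ∀ {v} → v ∈ X → v ∈ᵛ H
      P⊆H           : P ⊆ᵛ H
      Q⊆P           : Q ⊆ᵛ P
      X∩P≡∅         : ∀ {v} → v ∈ X → P v ≡ false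
      X-dominates-Q : ∀ {v} → v ∈ᵛ Q → ∃ λ x → x ∈ X × Adj G v x

  Rooted-extend : ∀ {H} (R : Rooted H) → ModelIn (_∈ᵛ Rooted.Q R) t → ModelIn (_∈ᵛ H) (suc t)
  Rooted-extend R = extend X-nonempty X-connected X∩Q≡∅ X-dominates-Q X⊆H (P⊆H ∘ Q⊆P)
    where
    open Rooted R
    X∩Q≡∅ : ∀ {v} → v ∈ X → ¬ v ∈ᵛ Q
    X∩Q≡∅ v∈X v∈Q with trans (sym (Q⊆P v∈Q)) (X∩P≡∅ v∈X)
    ... | ()

  star : ∀ {H w} → w ∈ᵛ H → Rooted H
  star {H} {w} w∈H = record
    { X             = ⁅ w ⁆
    ; P             = H ∖ w
    ; Q             = H ∖ w ∩ N w
    ; X-nonempty    = w , x∈⁅x⁆ w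
    ; X-connected   = ⁅⁆-connected
    ; X⊆H           = λ v∈X → subst (_∈ᵛ H) (sym (x∈⁅y⁆⇒x≡y w v∈X)) w∈H
    ; P⊆H           = ∖⊆ H w
    ; Q⊆P           = ∩⊆ˡ (H ∖ w) (N w)
    ; X∩P≡∅         = λ v∈X → subst (λ v → (H ∖ w) v ≡ false)
                                    (sym (x∈⁅y⁆⇒x≡y w v∈X)) (y∉S∖y H w)
    ; X-dominates-Q = λ v∈Q → w , x∈⁅x⁆ w , Adj-sym (∩⊆ʳ (H ∖ w) (N w) v∈Q)
    }

  contract : ∀ {H} (R : Rooted H) {y} → y ∈ᵛ Rooted.Q R → Rooted H
  contract {H} R {y} y∈Q = record
    { X             = X′
    ; P             = P ∖ y
    ; Q             = P ∖ y ∩ (Q ∪ N y)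
    ; X-nonempty    = let x , x∈X = X-nonempty in x , X⊆X′ x∈X
    ; X-connected   = let _ , x∈X , yx = X-dominates-Q y∈Q in ∪⁅⁆-connected X-connected x∈X yx
    ; X⊆H           = X′⊆H
    ; P⊆H           = P⊆H ∘ ∖⊆ P y
    ; Q⊆P           = ∩⊆ˡ (P ∖ y) (Q ∪ N y)
    ; X∩P≡∅         = X′∩P′≡∅
    ; X-dominates-Q = X′-dominates-Q′
    }
    where
    open Rooted R
    X′ : Subset n
    X′ = X Subset.∪ ⁅ y ⁆
    X⊆X′ : X ⊆ X′
    X⊆X′ = p⊆p∪q ⁅ y ⁆
    y∈X′ : y ∈ X′
    y∈X′ = q⊆p∪q X ⁅ y ⁆ (x∈⁅x⁆ y)
    X′⊆H : ∀ {v} → v ∈ X′ → v ∈ᵛ H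
    X′⊆H v∈X′ with x∈p∪q⁻ X ⁅ y ⁆ v∈X′
    ... | inj₁ v∈X = X⊆H v∈X
    ... | inj₂ v∈y with x∈⁅y⁆⇒x≡y y v∈y
    ...   | refl = P⊆H (Q⊆P y∈Q)
    X′∩P′≡∅ : ∀ {v} → v ∈ X′ → (P ∖ y) v ≡ false
    X′∩P′≡∅ v∈X′ with x∈p∪q⁻ X ⁅ y ⁆ v∈X′
    ... | inj₁ v∈X rewrite X∩P≡∅ v∈X = refl
    ... | inj₂ v∈y with x∈⁅y⁆⇒x≡y y v∈y
    ...   | refl = y∉S∖y P y
    X′-dominates-Q′ : ∀ {v} → v ∈ᵛ P ∖ y ∩ (Q ∪ N y) → ∃ λ x → x ∈ X′ × Adj G v x
    X′-dominates-Q′ v∈Q′ with ∪⁻ Q (N y) (∩⊆ʳ (P ∖ y) (Q ∪ N y) v∈Q′)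
    ... | inj₁ v∈Q = let x , x∈X , vx = X-dominates-Q v∈Q in x , X⊆X′ x∈X , vx
    ... | inj₂ yv  = y , y∈X′ , Adj-sym yv

  weight : VertexSet n → VertexSet n → ℕ
  weight P Q = degSum P + card Q * 2

  card-contract : ∀ {P Q y} → Q ⊆ᵛ P → y ∈ᵛ Q →
                  card Q + degIn (P ∖ y) y ≡ card (P ∖ y ∩ (Q ∪ N y)) + degIn Q y + 1
  card-contract {P} {Q} {y} Q⊆P y∈Q = begin
    card Q + degIn (P ∖ y) y                          ≡⟨ ∑-distrib-+ (𝟙 ∘ Q) _ ⟨
    sum (λ v → 𝟙 (Q v) + 𝟙 ((P ∖ y ∩ N y) v))        ≡⟨ ∑-point-split y 1 pointwise ⟩
    sum (λ v → 𝟙 (Q′ v) + 𝟙 ((Q ∩ N y) v)) + 1       ≡⟨ cong (_+ 1) (∑-distrib-+ (𝟙 ∘ Q′) _) ⟩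
    card Q′ + degIn Q y + 1                           ∎
    where
    open ≡-Reasoning
    Q′ : VertexSet n
    Q′ = P ∖ y ∩ (Q ∪ N y)
    pointwise : ∀ v → 𝟙 (Q v) + 𝟙 ((P ∖ y ∩ N y) v) ≡
                      𝟙 (Q′ v) + 𝟙 ((Q ∩ N y) v) + (if does (v ≟ y) then 1 else 0)
    pointwise v with v ≟ y
    ... | yes refl rewrite y∈Q | Q⊆P y∈Q | irrfl G v = refl
    ... | no _ with Q v in v∈Q
    ...   | true rewrite Q⊆P v∈Q with adj G y v
    ...     | true  = refl
    ...     | false = refl
    pointwise v | no _ | false with P v | adj G y v
    ...     | true  | true  = refl
    ...     | true  | false = refl
    ...     | false | _     = refl

  weight-contract : ∀ {P Q y} → Q ⊆ᵛ P → y ∈ᵛ Q →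
                    weight P Q ≡ weight (P ∖ y) (P ∖ y ∩ (Q ∪ N y)) + suc (degIn Q y) * 2
  weight-contract {P} {Q} {y} Q⊆P y∈Q = begin
    degSum P + card Q * 2                       ≡⟨ cong (_+ card Q * 2) (degSum-∖ (Q⊆P y∈Q)) ⟩
    degSum P′ + d * 2 + card Q * 2              ≡⟨ regroup (degSum P′) d (card Q) ⟩
    degSum P′ + (card Q + d) * 2                ≡⟨ cong (λ m → degSum P′ + m * 2) (card-contract Q⊆P y∈Q) ⟩
    degSum P′ + (card Q′ + degIn Q y + 1) * 2   ≡⟨ ungroup (degSum P′) (card Q′) (degIn Q y) ⟩
    degSum P′ + card Q′ * 2 + suc (degIn Q y) * 2  ∎
    where
    open ≡-Reasoning
    P′ Q′ : VertexSet n
    P′ = P ∖ y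
    Q′ = P ∖ y ∩ (Q ∪ N y)
    d : ℕ
    d = degIn P′ y
    regroup : ∀ a b c → a + b * 2 + c * 2 ≡ a + (c + b) * 2
    regroup = solve-∀
    ungroup : ∀ a b c → a + (b + c + 1) * 2 ≡ a + b * 2 + suc c * 2
    ungroup = solve-∀

  -- In terms of e(·): 2(j+1)|P| − 2j < 2e(P) + 2|Q|. Contracting y ∈ Q raises the
  -- slack by 2(j − deg_Q y), and no configuration with |P| = 1 satisfies it.
  Dense : ℕ → VertexSet n → VertexSet n → Set
  Dense j P Q = card P * (suc j * 2) < j * 2 + weight P Q

  record Config (j : ℕ) (H : VertexSet n) : Set where
    field
      rooted : Rooted H
    open Rooted rooted public
    field
      P-nonempty : 0 < card P
      dense      : Dense j P Q

  Dense⇒1<card : ∀ {j P Q} → Q ⊆ᵛ P → 0 < card P → Dense j P Q → 1 < card P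
  Dense⇒1<card {j} {P} {Q} Q⊆P 0<card dense = ≰⇒> λ card≤1 → <-irrefl refl (<-≤-trans dense (begin
    j * 2 + (degSum P + card Q * 2)  ≡⟨ cong (λ m → j * 2 + (m + card Q * 2)) (card≤1⇒degSum≡0 P card≤1) ⟩
    j * 2 + card Q * 2               ≤⟨ +-monoʳ-≤ (j * 2) (*-monoˡ-≤ 2 (card-Q≤1 card≤1)) ⟩
    j * 2 + 1 * 2                    ≡⟨ trans (+-comm (j * 2) 2) (sym (*-identityˡ (suc j * 2))) ⟩
    1 * (suc j * 2)                  ≡⟨ cong (_* (suc j * 2)) (≤-antisym card≤1 0<card) ⟨
    card P * (suc j * 2)             ∎))
    where
    open ≤-Reasoning
    card-Q≤1 : card P ≤ 1 → card Q ≤ 1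
    card-Q≤1 = ≤-trans (card-mono {S = Q} {P} Q⊆P)

  Config-contract : ∀ {j H} (C : Config j H) {y} → y ∈ᵛ Config.Q C → degIn (Config.Q C) y ≤ j →
                    Σ (Config j H) λ C′ → card (Config.P C′) < card (Config.P C)
  Config-contract {j} {H} C {y} y∈Q d≤j = C′ , ≤-reflexive (sym card-P≡)
    where
    open Config C
    card-P≡ : card P ≡ suc (card (P ∖ y))
    card-P≡ = card-∖ P (Q⊆P y∈Q)
    C′ : Config j H
    C′ = record
      { rooted     = contract rooted y∈Q
      ; P-nonempty = ≤-pred (subst (1 <_) card-P≡ (Dense⇒1<card {j = j} Q⊆P P-nonempty dense))
      ; dense      = dense-step (card (P ∖ y)) (weight (P ∖ y) (P ∖ y ∩ (Q ∪ N y))) d≤j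
                       (subst₂ (λ c w → c * (suc j * 2) < j * 2 + w) card-P≡ (weight-contract Q⊆P y∈Q) dense)
      }

  low-or-saturated : ∀ j S → (∃ λ y → y ∈ᵛ S × degIn S y ≤ j) ⊎ MinDegree (suc j) S
  low-or-saturated j S with any? (λ y → (S y ≟ᵇ true) ×-dec (degIn S y ≤? j))
  ... | yes low = inj₁ low
  ... | no ∄low = inj₂ λ y∈S → ≰⇒> λ low → ∄low (_ , y∈S , low)

  saturate : ∀ {j H} (C : Config j H) → Acc _<_ (card (Config.P C)) →
             Σ (Config j H) λ C′ →
               card (Config.P C′) ≤ card (Config.P C) × MinDegree (suc j) (Config.Q C′)
  saturate {j} C (acc smaller) with low-or-saturated j (Config.Q C)
  ... | inj₂ saturated = C , ≤-refl , saturated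
  ... | inj₁ (y , y∈Q , low) =
    let C′ , C′<C                = Config-contract C y∈Q low
        C″ , C″≤C′ , saturated = saturate C′ (smaller C′<C)
    in  C″ , ≤-trans C″≤C′ (<⇒≤ C′<C) , saturated

  star-config : ∀ j {H} → 1 < card H → (card H ∸ 1) * (suc j * 2) < j * 2 + degSum H →
                Σ (Config j H) λ C → card (Config.P C) < card H
  star-config j {H} 1<card dense with 0<card⇒member {S = H} (<-trans z<s 1<card)
  ... | w , w∈H = C , ≤-reflexive (sym card-H≡)
    where
    card-H≡ : card H ≡ suc (card (H ∖ w))
    card-H≡ = card-∖ H w∈H
    C : Config j H
    C = record
      { rooted     = star w∈H
      ; P-nonempty = ≤-pred (subst (1 <_) card-H≡ 1<card)
      ; dense      = subst₂ (λ p W → p * (suc j * 2) < j * 2 + W)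
                            (cong (_∸ 1) card-H≡) (degSum-∖ w∈H) dense
      }

  sparse-or-model : ∀ j (bound : ℕ → ℕ) → (∀ h → (h ∸ 1) * (suc j * 2) ≤ j * 2 + bound h) →
                    (∀ {H} (C : Config j H) → MinDegree (suc j) (Config.Q C) →
                       degSum (Config.P C) ≤ bound (card (Config.P C)) ⊎ ModelIn (_∈ᵛ Config.P C) t →
                       ModelIn (_∈ᵛ H) t) →
                    ∀ H → Acc _<_ (card H) → degSum H ≤ bound (card H) ⊎ ModelIn (_∈ᵛ H) t
  sparse-or-model j bound start finish H (acc smaller) with degSum H ≤? bound (card H)
  ... | yes sparse = inj₁ sparse
  ... | no ¬sparse =
    let C₀ , C₀<H            = star-config j (0<degSum⇒1<card H (≤-<-trans z≤n bound<degSum))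
                                           (≤-<-trans (start (card H)) (+-monoʳ-< (j * 2) bound<degSum))
        C , C≤C₀ , saturated = saturate C₀ (<-wellFounded _)
        IH                   = sparse-or-model j bound start finish (Config.P C)
                                                 (smaller (≤-<-trans C≤C₀ C₀<H))
    in  inj₂ (finish C saturated IH)
    where
    bound<degSum : bound (card H) < degSum H
    bound<degSum = ≰⇒> ¬sparse

  -- Dominating K₃- and K₄-models

  module _ {H} (C : Config 0 H) where
    open Config C

    K₃-from-saturated : MinDegree 1 Q → degSum P ≤ (card P ∸ 1) * 2 ⊎ ModelIn (_∈ᵛ P) 3 →
                        ModelIn (_∈ᵛ H) 3
    K₃-from-saturated saturated P-sparse-or-K₃ with 0 <? card Q
    ... | yes 0<card =
      let a , a∈Q      = 0<card⇒member {S = Q} 0<card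
          b , b∈Q , ab = 0<degIn⇒neighbour {S = Q} {a} (saturated a∈Q)
      in  Rooted-extend rooted (edge-model a∈Q b∈Q ab)
    ... | no ¬0<card with P-sparse-or-K₃
    ...   | inj₂ M      = ModelIn-mono P⊆H M
    ...   | inj₁ sparse = ⊥-elim (<-irrefl refl (<-≤-trans dense (begin
      degSum P + card Q * 2  ≤⟨ +-mono-≤ sparse (*-monoˡ-≤ 2 (≮⇒≥ ¬0<card)) ⟩
      (card P ∸ 1) * 2 + 0   ≡⟨ +-identityʳ _ ⟩
      (card P ∸ 1) * 2       ≤⟨ *-monoˡ-≤ 2 (m∸n≤m (card P) 1) ⟩
      card P * 2             ∎)))
      where open ≤-Reasoning

  sparse-or-K₃ : ∀ H → degSum H ≤ (card H ∸ 1) * 2 ⊎ ModelIn (_∈ᵛ H) 3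
  sparse-or-K₃ H =
    sparse-or-model 0 (λ h → (h ∸ 1) * 2) (λ _ → ≤-refl) K₃-from-saturated H (<-wellFounded _)

  module _ {H} (C : Config 1 H) where
    open Config C

    K₄-from-saturated : MinDegree 2 Q → degSum P ≤ (card P * 2 ∸ 3) * 2 ⊎ ModelIn (_∈ᵛ P) 4 →
                        ModelIn (_∈ᵛ H) 4
    K₄-from-saturated saturated (inj₂ M)      = ModelIn-mono P⊆H M
    K₄-from-saturated saturated (inj₁ sparse) with sparse-or-K₃ Q
    ... | inj₂ M        = Rooted-extend rooted M
    ... | inj₁ Q-sparse = ⊥-elim (<-irrefl refl (begin-strict
      card Q * 2        ≤⟨ MinDegree⇒card*k≤degSum Q saturated ⟩
      degSum Q          ≤⟨ Q-sparse ⟩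
      (card Q ∸ 1) * 2  <⟨ [n∸1]*2<n*2 0<card ⟩
      card Q * 2        ∎))
      where
      open ≤-Reasoning
      0<card : 0 < card Q
      0<card = ≰⇒> λ card≤0 → <-irrefl refl (<-≤-trans dense (begin
        2 + (degSum P + card Q * 2)     ≤⟨ +-monoʳ-≤ 2 (+-mono-≤ sparse (*-monoˡ-≤ 2 card≤0)) ⟩
        2 + ((card P * 2 ∸ 3) * 2 + 0)  ≡⟨ cong (2 +_) (+-identityʳ _) ⟩
        2 + (card P * 2 ∸ 3) * 2        ≤⟨ 2+[n*2∸3]*2≤n*4 P-nonempty ⟩
        card P * 4                      ∎))

  sparse-or-K₄ : ∀ H → degSum H ≤ (card H * 2 ∸ 3) * 2 ⊎ ModelIn (_∈ᵛ H) 4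
  sparse-or-K₄ H =
    sparse-or-model 1 (λ h → (h * 2 ∸ 3) * 2) [n∸1]*4≤2+[n*2∸3]*2 K₄-from-saturated H (<-wellFounded _)

corollary8 : (n : ℕ) → 2 ≤ n → (G : Graph n) → ¬ DominatingModel G 4 →
             edgeCount G ≤ 2 * n ∸ 3
corollary8 n _ G no-K₄ with sparse-or-K₄ G (λ _ → true)
... | inj₂ (M , _) = ⊥-elim (no-K₄ M)
... | inj₁ sparse  = *-cancelʳ-≤ (edgeCount G) (2 * n ∸ 3) 2 (begin
  edgeCount G * 2                         ≡⟨ handshake G ⟩
  degSum G (λ _ → true)                   ≤⟨ sparse ⟩
  (card {n} (λ _ → true) * 2 ∸ 3) * 2     ≡⟨ cong (λ m → (m * 2 ∸ 3) * 2) (card-all n) ⟩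
  (n * 2 ∸ 3) * 2                         ≡⟨ cong (λ m → (m ∸ 3) * 2) (*-comm n 2) ⟩
  (2 * n ∸ 3) * 2                         ∎)
  where open ≤-Reasoning
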